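{- The following statements are equivalent: (i) for every positive integer $k$ there are infinitely many pairs of primes of the form $\{p,p+2k\}$; (ii) every vertex $v\in\mathcal{E}$ has infinite out-degree $d^+_\infty(v)$ in $\overrightarrow{\mathcal{G}}_{\infty}$; (iii) every vertex $v\in\mathcal{E}$ has infinite degree $d_\infty(v)$ in $\mathcal{G}_{\infty}$.
   Context: Let $\mathcal{P}$ be the set of odd primes and $\mathcal{E}$ the set of non-negative even integers. $\overrightarrow{\mathcal{G}}_{\infty}$ is the directed graph with vertex set $\mathcal{E}$ and an arc $a\to b$ iff $\frac{a+b}{2}\in\mathcal{P}$ and $\frac{b-a}{2}\in\mathcal{P}$; $d^+_\infty(v)$ is the number of $w$ with $v\to w$. $\mathcal{G}_\infty$ is its underlying undirected graph (distinct $a,b\in\mathcal{E}$ adjacent iff $\frac{a+b}{2},\frac{|a-b|}{2}\in\mathcal{P}$), and $d_\infty(v)$ is the degree of $v$ there. -}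

module Defs where

open import Data.Nat using (ℕ; _+_; _*_; _∸_; _≤_; _<_; ∣_-_∣)
open import Data.Nat.Divisibility using (_∣_)
open import Data.Nat.Primality using (Prime)
open import Data.Product using (_×_; ∃-syntax)
open import Relation.Nullary using (¬_)
open import Relation.Binary.PropositionalEquality using (_≡_)

OddPrime : ℕ → Set
OddPrime p = Prime p × ¬ (p ≡ 2)

Even : ℕ → Set
Even n = 2 ∣ n

-- arc a → b in the directed graph G∞ (on ℰ):
-- (a+b)/2 ∈ 𝒫 and (b−a)/2 ∈ 𝒫
Arc : ℕ → ℕ → Set
Arc a b = Even a × Even b × a < b ×
  (∃[ p ] OddPrime p × a + b ≡ 2 * p) ×
  (∃[ q ] OddPrime q × b ∸ a ≡ 2 * q)

-- adjacency in the undirected graph G∞: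
-- distinct a,b ∈ ℰ with (a+b)/2 ∈ 𝒫 and |a−b|/2 ∈ 𝒫
Adj : ℕ → ℕ → Set
Adj a b = Even a × Even b × ¬ (a ≡ b) ×
  (∃[ p ] OddPrime p × a + b ≡ 2 * p) ×
  (∃[ q ] OddPrime q × ∣ a - b ∣ ≡ 2 * q)

Infinite : (ℕ → Set) → Set
Infinite P = ∀ N → ∃[ n ] N ≤ n × P n

PrimePairsConj : Set
PrimePairsConj = ∀ k → 1 ≤ k → Infinite (λ p → Prime p × Prime (p + 2 * k))

InfiniteOutDegree : Set
InfiniteOutDegree = ∀ v → Even v → Infinite (λ w → Arc v w)

InfiniteDegree : Set
InfiniteDegree = ∀ v → Even v → Infinite (λ w → Adj v w)

-- A vertex 2m has an arc to w exactly when (w − 2m)/2 = q and (w + 2m)/2 = q + 2m are both odd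
-- primes, so the out-neighbours of 2m correspond to prime pairs {q, q + 2m}.  Arcs are edges, and
-- an edge from 2k to a vertex above 2k is again an arc, so unboundedly many neighbours of 2k yield
-- unboundedly many prime pairs {q, q + 2k}.
module Submission where

open import Defs
open import Data.Product using (_×_; _,_; ∃-syntax)
open import Data.Nat using (zero; suc; _+_; _*_; _∸_; _≤_; z≤n; s≤s)
open import Data.Nat.Properties
open import Data.Nat.Divisibility using (divides; m∣m*n)
open import Data.Nat.Primality using (Prime)
open import Data.Nat.Tactic.RingSolver using (solve-∀)
open import Relation.Binary.PropositionalEquality

oddPrime : ∀ {p} → 3 ≤ p → Prime p → OddPrime p
oddPrime 3≤p pp = pp , >⇒≢ 3≤p

-- For gap 0 the pair degenerates to a single prime, which is what the vertex 0 needs.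
primePairsWithGap : PrimePairsConj → ∀ m → Infinite (λ p → Prime p × Prime (p + 2 * m))
primePairsWithGap H zero N with H 1 (s≤s z≤n) N
... | p , N≤p , pp , _ = p , N≤p , pp , subst Prime (sym (+-identityʳ p)) pp
primePairsWithGap H (suc m) = H (suc m) (s≤s z≤n)

2m+2[p+m]≡2[p+2m] : ∀ p m → 2 * m + 2 * (p + m) ≡ 2 * (p + 2 * m)
2m+2[p+m]≡2[p+2m] = solve-∀

primePair⇒arc : ∀ m {p} → 3 ≤ p → Prime p → Prime (p + 2 * m) → Arc (2 * m) (2 * (p + m))
primePair⇒arc m {p} 3≤p pp pp′ =
  m∣m*n m , m∣m*n (p + m) , *-monoʳ-< 2 (m<n+m m (≤-trans (s≤s z≤n) 3≤p)) ,
  (p + 2 * m , oddPrime (≤-trans 3≤p (m≤m+n p _)) pp′ , 2m+2[p+m]≡2[p+2m] p m) ,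
  (p , oddPrime 3≤p pp , difference≡)
  where
  difference≡ : 2 * (p + m) ∸ 2 * m ≡ 2 * p
  difference≡ = begin
    2 * (p + m) ∸ 2 * m       ≡⟨ cong (_∸ 2 * m) (*-distribˡ-+ 2 p m) ⟩
    2 * p + 2 * m ∸ 2 * m     ≡⟨ m+n∸n≡m (2 * p) (2 * m) ⟩
    2 * p                     ∎
    where open ≡-Reasoning

arc⇒adj : ∀ {a b} → Arc a b → Adj a b
arc⇒adj (ea , eb , a<b , sum , (q , oq , b∸a≡)) =
  ea , eb , <⇒≢ a<b , sum , (q , oq , trans (m≤n⇒∣m-n∣≡n∸m (<⇒≤ a<b)) b∸a≡)

neighbourAbove⇒primePair : ∀ k {w} → 2 * k ≤ w → Adj (2 * k) w →
                           ∃[ q ] w ≡ 2 * (q + k) × Prime q × Prime (q + 2 * k)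
neighbourAbove⇒primePair k {w} 2k≤w (_ , _ , _ , (p , (pp , _) , sum≡) , (q , (pq , _) , difference≡)) =
  q , w≡ , pq , subst Prime p≡ pp
  where
  w≡ : w ≡ 2 * (q + k)
  w≡ = begin
    w                   ≡⟨ m∸n+n≡m 2k≤w ⟨
    w ∸ 2 * k + 2 * k   ≡⟨ cong (_+ 2 * k) (trans (sym (m≤n⇒∣m-n∣≡n∸m 2k≤w)) difference≡) ⟩
    2 * q + 2 * k       ≡⟨ *-distribˡ-+ 2 q k ⟨
    2 * (q + k)         ∎
    where open ≡-Reasoning
  p≡ : p ≡ q + 2 * k
  p≡ = *-cancelˡ-≡ p (q + 2 * k) 2 (trans (sym sum≡) (trans (cong (2 * k +_) w≡) (2m+2[p+m]≡2[p+2m] q k)))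

i⇒ii : PrimePairsConj → InfiniteOutDegree
i⇒ii H .(m * 2) (divides m refl) N rewrite *-comm m 2 with primePairsWithGap H m (N + 3)
... | p , N+3≤p , pp , pp′ =
  2 * (p + m) , N≤w , primePair⇒arc m (≤-trans (m≤n+m 3 N) N+3≤p) pp pp′
  where
  N≤w : N ≤ 2 * (p + m)
  N≤w = ≤-trans (≤-trans (m≤m+n N 3) N+3≤p) (≤-trans (m≤m+n p m) (m≤n*m (p + m) 2))

ii⇒iii : InfiniteOutDegree → InfiniteDegree
ii⇒iii H v ev N with H v ev N
... | w , N≤w , arc = w , N≤w , arc⇒adj arc

iii⇒i : InfiniteDegree → PrimePairsConj
iii⇒i H k _ N with H (2 * k) (m∣m*n k) (2 * (N + k))
... | w , 2[N+k]≤w , adj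
  with neighbourAbove⇒primePair k (≤-trans (*-monoʳ-≤ 2 (m≤n+m k N)) 2[N+k]≤w) adj
...   | q , refl , pq , pq′ = q , +-cancelʳ-≤ k N q (*-cancelˡ-≤ 2 2[N+k]≤w) , pq , pq′

mainTheorem7 : (PrimePairsConj → InfiniteOutDegree) × (InfiniteOutDegree → InfiniteDegree) × (InfiniteDegree → PrimePairsConj)
mainTheorem7 = i⇒ii , ii⇒iii , iii⇒i
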